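{- For every nonnegative integer $n$, \[ \sum_{k=0}^{\lfloor n/2\rfloor}\frac{(q^{ -n};q)_{2k}}{(q;q)_k\,(q^{ -n};q)_k}\,q^k= \begin{cases}(-1)^{\lfloor n/3\rfloor}q^{ -n(n-1)/6}, & n\not\equiv 2 \pmod 3,\\ 0, & n\equiv 2\pmod 3.\end{cases} \]
   Context: For a nonnegative integer $m$, $(a;q)_m=\prod_{i=0}^{m-1}(1-aq^i)$. The identity is an identity of rational functions (Laurent polynomials) in $q$. -}

module Defs where

open import Data.Nat as ℕ using (ℕ; zero; suc)
open import Data.Rational using (ℚ; 0ℚ; 1ℚ; _+_; _*_; _-_; -_; 1/_; ≢-nonZero)
open import Data.Rational.Properties using (_≟_)
open import Relation.Nullary using (yes; no)

-- total inverse on ℚ (inv 0 = 0); only used where the argument is nonzero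
inv : ℚ → ℚ
inv p with p ≟ 0ℚ
... | yes _ = 0ℚ
... | no ne = 1/_ p {{≢-nonZero ne}}

_÷_ : ℚ → ℚ → ℚ
p ÷ r = p * inv r

_^_ : ℚ → ℕ → ℚ
p ^ zero = 1ℚ
p ^ suc m = p * (p ^ m)

_^-_ : ℚ → ℕ → ℚ
p ^- m = inv p ^ m

qPoch : ℚ → ℚ → ℕ → ℚ
qPoch a q zero = 1ℚ
qPoch a q (suc m) = qPoch a q m * (1ℚ - a * (q ^ m))

sumTo : ℕ → (ℕ → ℚ) → ℚ
sumTo zero f = f zero
sumTo (suc N) f = sumTo N f + f (suc N)

term : ℚ → ℕ → ℕ → ℚ
term q n k = (qPoch (q ^- n) q (2 ℕ.* k) ÷ (qPoch q q k * qPoch (q ^- n) q k)) * (q ^ k)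

lhs : ℚ → ℕ → ℚ
lhs q n = sumTo (n ℕ./ 2) (term q n)

rhs : ℚ → ℕ → ℚ
rhs q n with n ℕ.% 3
... | 2 = 0ℚ
... | _ = ((- 1ℚ) ^ (n ℕ./ 3)) * (q ^- ((n ℕ.* (n ℕ.∸ 1)) ℕ./ 6))

{-# OPTIONS --safe #-}
-- Write p = q⁻¹ and w p m k = (-1)ᵏ p^(k(k-1)/2) [m k]_p. Splitting (q^(-n); q)_(2k) into
-- (q^(-n); q)_k (q^(k-n); q)_k turns the k-th summand into w p (n - k) k; the denominators are
-- nonzero because q ≠ 0, ±1 is not a root of unity in ℚ. As w p m k = 0 for k > m, the left-hand
-- side is the diagonal sum aₙ = Σ_{m+k=n} w p m k. The two p-Pascal rules for w give, with
-- bₙ = Σ_{m+k=n} pᵏ w p m k,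
--   a_(n+2) = b_(n+1) - bₙ   and   b_(n+2) = b_(n+1) - p^(n+1) aₙ,
-- so a_(n+3) = -p^(n+1) aₙ. The right-hand side obeys the same recurrence, and both sides take
-- the values 1, 1, 0 at n = 0, 1, 2.
module Submission where

open import Defs
open import Data.Nat using (ℕ)
open import Data.Rational using (ℚ; 0ℚ; 1ℚ; -_)
open import Relation.Binary.PropositionalEquality using (_≡_; _≢_)

open import Algebra.Apartness.Properties.HeytingCommutativeRing using (x#0y#0→xy#0)
open import Algebra.Bundles using (CommutativeMonoid)
import Algebra.Properties.CommutativeSemigroup as CommutativeSemigroupProperties
import Algebra.Properties.Group as GroupProperties
open import Data.Nat as ℕ using (zero; suc; _∸_; _≤_; _<_; z≤n; s≤s)
open import Data.Nat.DivMod using (_/_; _%_; m/n≤m; m*n/n≡m; /-monoˡ-≤; /-congˡ; +-distrib-/-∣ʳ; m/n≡1+[m∸n]/n)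
open import Data.Nat.Divisibility using (divides)
import Data.Nat.Properties as ℕₚ
import Data.Nat.Tactic.RingSolver as ℕ-Solver
import Data.Rational as ℚ
open import Data.Rational using (_+_; _*_; _-_; Positive; positive; negative; ≢-nonZero)
open import Data.Rational.Properties
  using (_≟_; +-*-commutativeRing; heytingCommutativeRing; +-0-group; *-1-commutativeMonoid;
         *-inverseʳ; *-identityˡ; *-identityʳ; *-comm; *-zeroˡ; *-zeroʳ; *-assoc; +-identityʳ; +-assoc;
         <-cmp; <-irrefl; <-trans; <-respˡ-≡; <-respʳ-≡; *-distribˡ-+; *-monoʳ-<-pos; pos*pos⇒pos; neg*neg⇒pos)
open import Function.Base using (_∘_)
open import Level using (0ℓ)
open import Relation.Binary.Definitions using (tri<; tri≈; tri>)
open import Relation.Binary.PropositionalEquality using (refl; sym; trans; cong; cong₂; subst; ≢-sym; module ≡-Reasoning)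
open import Relation.Nullary using (¬_; yes; no; contradiction)
open import Relation.Nullary.Decidable using (dec⇒maybe)
open import Tactic.RingSolver using (solve-∀)
open import Tactic.RingSolver.Core.AlmostCommutativeRing using (AlmostCommutativeRing; fromCommutativeRing)

open CommutativeSemigroupProperties (CommutativeMonoid.commutativeSemigroup *-1-commutativeMonoid)
  using (interchange; xy∙z≈xz∙y; x∙yz≈y∙xz)
open GroupProperties +-0-group using (x∙y⁻¹≈ε⇒x≈y)
open ≡-Reasoning

ℚ-ring : AlmostCommutativeRing 0ℓ 0ℓ
ℚ-ring = fromCommutativeRing +-*-commutativeRing (λ x → dec⇒maybe (0ℚ ≟ x))

private
  variable
    p q a x y : ℚ
    k m n : ℕ

*-inv : x ≢ 0ℚ → x * inv x ≡ 1ℚ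
*-inv {x} x≢0 with x ≟ 0ℚ
... | yes x≡0 = contradiction x≡0 x≢0
... | no  x≢0′ = *-inverseʳ x {{≢-nonZero x≢0′}}

x*y≢0 : x ≢ 0ℚ → y ≢ 0ℚ → x * y ≢ 0ℚ
x*y≢0 = x#0y#0→xy#0 heytingCommutativeRing

x-y≢0 : x ≢ y → x - y ≢ 0ℚ
x-y≢0 {x} {y} x≢y = x≢y ∘ x∙y⁻¹≈ε⇒x≈y x y

^-+ : ∀ x m n → x ^ (m ℕ.+ n) ≡ x ^ m * x ^ n
^-+ x zero    n = sym (*-identityˡ (x ^ n))
^-+ x (suc m) n = trans (cong (x *_) (^-+ x m n)) (sym (*-assoc x (x ^ m) (x ^ n)))

^-distrib-* : ∀ x y n → (x * y) ^ n ≡ x ^ n * y ^ n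
^-distrib-* x y zero    = refl
^-distrib-* x y (suc n) = trans (cong ((x * y) *_) (^-distrib-* x y n)) (interchange x y (x ^ n) (y ^ n))

1^n≡1 : ∀ n → 1ℚ ^ n ≡ 1ℚ
1^n≡1 zero    = refl
1^n≡1 (suc n) = trans (cong (1ℚ *_) (1^n≡1 n)) (*-identityˡ 1ℚ)

^-inverse : p * q ≡ 1ℚ → ∀ n → p ^ n * q ^ n ≡ 1ℚ
^-inverse {p} {q} pq≡1 n = trans (sym (^-distrib-* p q n)) (trans (cong (_^ n) pq≡1) (1^n≡1 n))

^-cancel : p * q ≡ 1ℚ → ∀ i m → i ℕ.+ m ≡ n → p ^ n * q ^ i ≡ p ^ m
^-cancel {p} {q} pq≡1 i m refl = begin
  p ^ (i ℕ.+ m) * q ^ i    ≡⟨ cong (_* q ^ i) (^-+ p i m) ⟩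
  p ^ i * p ^ m * q ^ i    ≡⟨ xy∙z≈xz∙y (p ^ i) (p ^ m) (q ^ i) ⟩
  p ^ i * q ^ i * p ^ m    ≡⟨ cong (_* p ^ m) (^-inverse {p} pq≡1 i) ⟩
  1ℚ * p ^ m               ≡⟨ *-identityˡ (p ^ m) ⟩
  p ^ m                    ∎

^-≢1-inverse : p * q ≡ 1ℚ → ∀ n → q ^ n ≢ 1ℚ → p ^ n ≢ 1ℚ
^-≢1-inverse {p} {q} pq≡1 n qⁿ≢1 pⁿ≡1 = qⁿ≢1 (begin
  q ^ n            ≡⟨ *-identityˡ (q ^ n) ⟨
  1ℚ * q ^ n       ≡⟨ cong (_* q ^ n) pⁿ≡1 ⟨
  p ^ n * q ^ n    ≡⟨ ^-inverse pq≡1 n ⟩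
  1ℚ               ∎)

^-suc-<1 : Positive x → x ℚ.< 1ℚ → ∀ j → x ^ suc j ℚ.< 1ℚ
^-suc-<1 {x} x>0 x<1 zero    = <-respˡ-≡ (sym (*-identityʳ x)) x<1
^-suc-<1 {x} x>0 x<1 (suc j) =
  <-trans (<-respʳ-≡ (*-identityʳ x) (*-monoʳ-<-pos x {{x>0}} (^-suc-<1 x>0 x<1 j))) x<1

1<^-suc : Positive x → 1ℚ ℚ.< x → ∀ j → 1ℚ ℚ.< x ^ suc j
1<^-suc {x} x>0 1<x zero    = <-respʳ-≡ (sym (*-identityʳ x)) 1<x
1<^-suc {x} x>0 1<x (suc j) =
  <-trans 1<x (<-respˡ-≡ (*-identityʳ x) (*-monoʳ-<-pos x {{x>0}} (1<^-suc x>0 1<x j)))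

pos-^-suc-≢1 : Positive x → x ≢ 1ℚ → ∀ j → x ^ suc j ≢ 1ℚ
pos-^-suc-≢1 {x} x>0 x≢1 j with <-cmp x 1ℚ
... | tri< x<1 _ _ = λ xʲ⁺¹≡1 → <-irrefl xʲ⁺¹≡1 (^-suc-<1 x>0 x<1 j)
... | tri≈ _ x≡1 _ = contradiction x≡1 x≢1
... | tri> _ _ 1<x = λ xʲ⁺¹≡1 → <-irrefl (sym xʲ⁺¹≡1) (1<^-suc x>0 1<x j)

x²-pos : x ≢ 0ℚ → Positive (x * x)
x²-pos {x} x≢0 with <-cmp x 0ℚ
... | tri< x<0 _ _ = neg*neg⇒pos x {{negative x<0}} x {{negative x<0}}
... | tri≈ _ x≡0 _ = contradiction x≡0 x≢0
... | tri> _ _ x>0 = pos*pos⇒pos x {{positive x>0}} x {{positive x>0}}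

x²≢1 : x ≢ 1ℚ → x ≢ - 1ℚ → x * x ≢ 1ℚ
x²≢1 {x} x≢1 x≢-1 x²≡1 = x*y≢0 (x-y≢0 x≢1) (x-y≢0 x≢-1) (begin
  (x - 1ℚ) * (x - - 1ℚ)   ≡⟨ difference-of-squares x ⟩
  x * x - 1ℚ              ≡⟨ cong (_- 1ℚ) x²≡1 ⟩
  0ℚ                      ∎)
  where
  difference-of-squares : ∀ x → (x - 1ℚ) * (x - - 1ℚ) ≡ x * x - 1ℚ
  difference-of-squares = solve-∀ ℚ-ring

^-suc-≢1 : q ≢ 0ℚ → q ≢ 1ℚ → q ≢ - 1ℚ → ∀ j → q ^ suc j ≢ 1ℚ
^-suc-≢1 {q} q≢0 q≢1 q≢-1 j qʲ⁺¹≡1 = pos-^-suc-≢1 (x²-pos q≢0) (x²≢1 q≢1 q≢-1) j (begin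
  (q * q) ^ suc j             ≡⟨ ^-distrib-* q q (suc j) ⟩
  q ^ suc j * q ^ suc j       ≡⟨ cong₂ _*_ qʲ⁺¹≡1 qʲ⁺¹≡1 ⟩
  1ℚ                          ∎)

qPoch-+ : ∀ a q k j → qPoch a q (k ℕ.+ j) ≡ qPoch a q k * qPoch (a * q ^ k) q j
qPoch-+ a q k zero    = trans (cong (qPoch a q) (ℕₚ.+-identityʳ k)) (sym (*-identityʳ (qPoch a q k)))
qPoch-+ a q k (suc j) = begin
  qPoch a q (k ℕ.+ suc j)                                   ≡⟨ cong (qPoch a q) (ℕₚ.+-suc k j) ⟩
  qPoch a q (k ℕ.+ j) * (1ℚ - a * q ^ (k ℕ.+ j))            ≡⟨ cong₂ (λ P x → P * (1ℚ - a * x)) (qPoch-+ a q k j) (^-+ q k j) ⟩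
  qPoch a q k * R * (1ℚ - a * (q ^ k * q ^ j))              ≡⟨ regroup (qPoch a q k) R a (q ^ k) (q ^ j) ⟩
  qPoch a q k * (R * (1ℚ - a * q ^ k * q ^ j))              ∎
  where
  R = qPoch (a * q ^ k) q j
  regroup : ∀ P R a x y → P * R * (1ℚ - a * (x * y)) ≡ P * (R * (1ℚ - a * x * y))
  regroup = solve-∀ ℚ-ring

qPoch-1 : ∀ q k → qPoch 1ℚ q (suc k) ≡ 0ℚ
qPoch-1 q k = trans (qPoch-+ 1ℚ q 1 k) (*-zeroˡ (qPoch (1ℚ * q ^ 1) q k))

qPoch-shift : p * q ≡ 1ℚ → ∀ a k → qPoch (p * a) q (suc k) ≡ (1ℚ - p * a) * qPoch a q k
qPoch-shift {p} {q} pq≡1 a k = begin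
  qPoch (p * a) q (1 ℕ.+ k)                                 ≡⟨ qPoch-+ (p * a) q 1 k ⟩
  1ℚ * (1ℚ - p * a * 1ℚ) * qPoch (p * a * (q * 1ℚ)) q k     ≡⟨ cong₂ (λ c b → c * qPoch b q k) (first-factor (p * a)) shifted ⟩
  (1ℚ - p * a) * qPoch a q k                                ∎
  where
  first-factor : ∀ x → 1ℚ * (1ℚ - x * 1ℚ) ≡ 1ℚ - x
  first-factor = solve-∀ ℚ-ring
  shifted : p * a * (q * 1ℚ) ≡ a
  shifted = trans (cong (p * a *_) (*-identityʳ q)) (trans (xy∙z≈xz∙y p a q) (trans (cong (_* a) pq≡1) (*-identityˡ a)))

qPoch-≢0 : ∀ k → (∀ i → i < k → a * q ^ i ≢ 1ℚ) → qPoch a q k ≢ 0ℚ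
qPoch-≢0 zero    _ ()
qPoch-≢0 (suc k) factor≢1 =
  x*y≢0 (qPoch-≢0 k (λ i i<k → factor≢1 i (ℕₚ.m<n⇒m<1+n i<k))) (x-y≢0 (≢-sym (factor≢1 k (ℕₚ.n<1+n k))))

-- signedGaussian p m k = (-1)ᵏ p^(k(k-1)/2) [m k]_p, with [m k]_p the Gaussian binomial coefficient.
signedGaussian : ℚ → ℕ → ℕ → ℚ
signedGaussian p m       zero    = 1ℚ
signedGaussian p zero    (suc k) = 0ℚ
signedGaussian p (suc m) (suc k) = signedGaussian p m (suc k) - p ^ m * signedGaussian p m k

signedGaussian-vanishes : ∀ p → m < k → signedGaussian p m k ≡ 0ℚ
signedGaussian-vanishes {zero}  {suc k} p _          = refl
signedGaussian-vanishes {suc m} {suc k} p (s≤s m<k) = begin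
  signedGaussian p m (suc k) - p ^ m * signedGaussian p m k
    ≡⟨ cong₂ (λ u v → u - p ^ m * v) (signedGaussian-vanishes p (ℕₚ.m<n⇒m<1+n m<k)) (signedGaussian-vanishes p m<k) ⟩
  0ℚ - p ^ m * 0ℚ
    ≡⟨ cong (λ z → 0ℚ - z) (*-zeroʳ (p ^ m)) ⟩
  0ℚ ∎

signedGaussian-pascal : ∀ p m k →
  signedGaussian p (suc m) (suc k) ≡ p ^ suc k * signedGaussian p m (suc k) - p ^ k * signedGaussian p m k
signedGaussian-pascal p zero    zero    = cong (_- 1ℚ * 1ℚ) (sym (*-zeroʳ (p * 1ℚ)))
signedGaussian-pascal p zero    (suc k) = cong₂ _-_ (sym (*-zeroʳ (p ^ suc (suc k)))) (sym (*-zeroʳ (p ^ suc k)))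
signedGaussian-pascal p (suc m) zero    = begin
  W (suc m) 1 - p ^ suc m * 1ℚ                              ≡⟨ cong (_- p ^ suc m * 1ℚ) (signedGaussian-pascal p m zero) ⟩
  p * 1ℚ * W m 1 - 1ℚ * 1ℚ - p * p ^ m * 1ℚ                 ≡⟨ regroup p (p ^ m) (W m 1) ⟩
  p * 1ℚ * (W m 1 - p ^ m * 1ℚ) - 1ℚ * 1ℚ                   ∎
  where
  W = signedGaussian p
  regroup : ∀ p M W₁ → p * 1ℚ * W₁ - 1ℚ * 1ℚ - p * M * 1ℚ ≡ p * 1ℚ * (W₁ - M * 1ℚ) - 1ℚ * 1ℚ
  regroup = solve-∀ ℚ-ring
signedGaussian-pascal p (suc m) (suc k) = begin
  W (suc m) (suc (suc k)) - p ^ suc m * W (suc m) (suc k)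
    ≡⟨ cong₂ (λ u v → u - p ^ suc m * v) (signedGaussian-pascal p m (suc k)) (signedGaussian-pascal p m k) ⟩
  (p ^ suc (suc k) * W m (suc (suc k)) - p ^ suc k * W m (suc k)) - p ^ suc m * (p ^ suc k * W m (suc k) - p ^ k * W m k)
    ≡⟨ regroup p (p ^ m) (p ^ k) (W m k) (W m (suc k)) (W m (suc (suc k))) ⟩
  p ^ suc (suc k) * (W m (suc (suc k)) - p ^ m * W m (suc k)) - p ^ suc k * (W m (suc k) - p ^ m * W m k)
    ∎
  where
  W = signedGaussian p
  regroup : ∀ p M K W₀ W₁ W₂ →
    (p * (p * K) * W₂ - p * K * W₁) - p * M * (p * K * W₁ - K * W₀) ≡
    p * (p * K) * (W₂ - M * W₁) - p * K * (W₁ - M * W₀)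
  regroup = solve-∀ ℚ-ring

-- Both sides follow the defining recurrence of signedGaussian, since (p^(m+1); q)_(k+1) = (1 - p^(m+1)) (p^m; q)_k.
signedGaussian-qPoch : p * q ≡ 1ℚ → ∀ m k → qPoch (p ^ m) q k * q ^ k ≡ signedGaussian p m k * qPoch q q k
signedGaussian-qPoch pq≡1 m zero = refl
signedGaussian-qPoch {p} {q} pq≡1 zero (suc k) = begin
  qPoch 1ℚ q (suc k) * q ^ suc k      ≡⟨ cong (_* q ^ suc k) (qPoch-1 q k) ⟩
  0ℚ * q ^ suc k                      ≡⟨ *-zeroˡ (q ^ suc k) ⟩
  0ℚ                                  ≡⟨ *-zeroˡ (qPoch q q (suc k)) ⟨
  0ℚ * qPoch q q (suc k)              ∎
signedGaussian-qPoch {p} {q} pq≡1 (suc m) (suc k) = begin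
  qPoch (p * pᵐ) q (suc k) * (q * qᵏ)
    ≡⟨ cong (_* (q * qᵏ)) (qPoch-shift {p} pq≡1 pᵐ k) ⟩
  (1ℚ - p * pᵐ) * P * (q * qᵏ)
    ≡⟨ expand p q pᵐ P qᵏ ⟩
  P * (q * qᵏ) - p * q * (pᵐ * P * qᵏ)
    ≡⟨ cong (λ c → P * (q * qᵏ) - c * (pᵐ * P * qᵏ)) pq≡1 ⟩
  P * (q * qᵏ) - 1ℚ * (pᵐ * P * qᵏ)
    ≡⟨ regroup pᵐ P q qᵏ ⟩
  P * (1ℚ - pᵐ * qᵏ) * (q * qᵏ) - pᵐ * (P * qᵏ * (1ℚ - q * qᵏ))
    ≡⟨ cong₂ (λ u v → u - pᵐ * (v * (1ℚ - q * qᵏ))) (signedGaussian-qPoch pq≡1 m (suc k)) (signedGaussian-qPoch pq≡1 m k) ⟩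
  W m (suc k) * (Q * (1ℚ - q * qᵏ)) - pᵐ * (W m k * Q * (1ℚ - q * qᵏ))
    ≡⟨ factor pᵐ (W m (suc k)) (W m k) Q (1ℚ - q * qᵏ) ⟩
  (W m (suc k) - pᵐ * W m k) * (Q * (1ℚ - q * qᵏ))
    ∎
  where
  W = signedGaussian p
  pᵐ = p ^ m
  qᵏ = q ^ k
  P = qPoch pᵐ q k
  Q = qPoch q q k
  expand : ∀ p q a P x → (1ℚ - p * a) * P * (q * x) ≡ P * (q * x) - p * q * (a * P * x)
  expand = solve-∀ ℚ-ring
  regroup : ∀ a P q x → P * (q * x) - 1ℚ * (a * P * x) ≡ P * (1ℚ - a * x) * (q * x) - a * (P * x * (1ℚ - q * x))
  regroup = solve-∀ ℚ-ring
  factor : ∀ a W₁ W₀ Q f → W₁ * (Q * f) - a * (W₀ * Q * f) ≡ (W₁ - a * W₀) * (Q * f)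
  factor = solve-∀ ℚ-ring

diagonalSum : (ℕ → ℕ → ℚ) → ℕ → ℚ
diagonalSum f zero    = f zero zero
diagonalSum f (suc n) = f (suc n) zero + diagonalSum (λ m k → f m (suc k)) n

diagonalSum-cong : ∀ {f g} → (∀ m k → f m k ≡ g m k) → ∀ n → diagonalSum f n ≡ diagonalSum g n
diagonalSum-cong f≗g zero    = f≗g 0 0
diagonalSum-cong f≗g (suc n) = cong₂ _+_ (f≗g (suc n) 0) (diagonalSum-cong (λ m k → f≗g m (suc k)) n)

diagonalSum-- : ∀ f g n → diagonalSum (λ m k → f m k - g m k) n ≡ diagonalSum f n - diagonalSum g n
diagonalSum-- f g zero    = refl
diagonalSum-- f g (suc n) = begin
  (f (suc n) 0 - g (suc n) 0) + diagonalSum (λ m k → f₊ m k - g₊ m k) n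
    ≡⟨ cong ((f (suc n) 0 - g (suc n) 0) +_) (diagonalSum-- f₊ g₊ n) ⟩
  (f (suc n) 0 - g (suc n) 0) + (diagonalSum f₊ n - diagonalSum g₊ n)
    ≡⟨ interchange-- (f (suc n) 0) (g (suc n) 0) (diagonalSum f₊ n) (diagonalSum g₊ n) ⟩
  (f (suc n) 0 + diagonalSum f₊ n) - (g (suc n) 0 + diagonalSum g₊ n)
    ∎
  where
  f₊ g₊ : ℕ → ℕ → ℚ
  f₊ m k = f m (suc k)
  g₊ m k = g m (suc k)
  interchange-- : ∀ a b c d → (a - b) + (c - d) ≡ (a + c) - (b + d)
  interchange-- = solve-∀ ℚ-ring

diagonalSum-*ˡ : ∀ c f n → diagonalSum (λ m k → c * f m k) n ≡ c * diagonalSum f n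
diagonalSum-*ˡ c f zero    = refl
diagonalSum-*ˡ c f (suc n) = trans (cong (c * f (suc n) 0 +_) (diagonalSum-*ˡ c (λ m k → f m (suc k)) n))
                                   (sym (*-distribˡ-+ c (f (suc n) 0) (diagonalSum (λ m k → f m (suc k)) n)))

diagonalSum-homogeneous : ∀ p f n → diagonalSum (λ m k → p ^ m * p ^ k * f m k) n ≡ p ^ n * diagonalSum f n
diagonalSum-homogeneous p f zero    = cong (_* f 0 0) (*-identityˡ 1ℚ)
diagonalSum-homogeneous p f (suc n) = begin
  head + diagonalSum (λ m k → p ^ m * (p * p ^ k) * f₊ m k) n
    ≡⟨ cong (head +_) (diagonalSum-cong (λ m k → pull-out p (p ^ m) (p ^ k) (f₊ m k)) n) ⟩
  head + diagonalSum (λ m k → p ^ m * p ^ k * (p * f₊ m k)) n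
    ≡⟨ cong (head +_) (diagonalSum-homogeneous p (λ m k → p * f₊ m k) n) ⟩
  head + p ^ n * diagonalSum (λ m k → p * f₊ m k) n
    ≡⟨ cong (λ s → head + p ^ n * s) (diagonalSum-*ˡ p f₊ n) ⟩
  head + p ^ n * (p * diagonalSum f₊ n)
    ≡⟨ collect p (p ^ n) (f (suc n) 0) (diagonalSum f₊ n) ⟩
  p ^ suc n * (f (suc n) 0 + diagonalSum f₊ n)
    ∎
  where
  head = p ^ suc n * 1ℚ * f (suc n) 0
  f₊ : ℕ → ℕ → ℚ
  f₊ m k = f m (suc k)
  pull-out : ∀ p M K y → M * (p * K) * y ≡ M * K * (p * y)
  pull-out = solve-∀ ℚ-ring
  collect : ∀ p N y z → p * N * 1ℚ * y + N * (p * z) ≡ p * N * (y + z)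
  collect = solve-∀ ℚ-ring

diagonalSum-suc : ∀ f n → diagonalSum f (suc n) ≡ diagonalSum (λ m k → f (suc m) k) n + f 0 (suc n)
diagonalSum-suc f zero    = refl
diagonalSum-suc f (suc n) =
  trans (cong (f (suc (suc n)) 0 +_) (diagonalSum-suc (λ m k → f m (suc k)) n))
        (sym (+-assoc (f (suc (suc n)) 0) (diagonalSum (λ m k → f (suc m) (suc k)) n) (f 0 (suc (suc n)))))

diagonal : ℚ → ℕ → ℚ
diagonal p = diagonalSum (signedGaussian p)

weightedDiagonal : ℚ → ℕ → ℚ
weightedDiagonal p = diagonalSum (λ m k → p ^ k * signedGaussian p m k)

diagonal-suc-suc : ∀ p n → diagonal p (suc (suc n)) ≡ weightedDiagonal p (suc n) - weightedDiagonal p n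
diagonal-suc-suc p n = begin
  1ℚ + diagonalSum (λ m k → W m (suc k)) (suc n)
    ≡⟨ cong (1ℚ +_) (diagonalSum-suc (λ m k → W m (suc k)) n) ⟩
  1ℚ + (diagonalSum (λ m k → W (suc m) (suc k)) n + 0ℚ)
    ≡⟨ cong (λ s → 1ℚ + (s + 0ℚ)) (diagonalSum-cong (signedGaussian-pascal p) n) ⟩
  1ℚ + (diagonalSum (λ m k → p ^ suc k * W m (suc k) - p ^ k * W m k) n + 0ℚ)
    ≡⟨ cong (λ s → 1ℚ + (s + 0ℚ)) (diagonalSum-- (λ m k → p ^ suc k * W m (suc k)) (λ m k → p ^ k * W m k) n) ⟩
  1ℚ + (S - weightedDiagonal p n + 0ℚ)
    ≡⟨ regroup S (weightedDiagonal p n) ⟩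
  1ℚ + S - weightedDiagonal p n
    ∎
  where
  W = signedGaussian p
  S = diagonalSum (λ m k → p ^ suc k * W m (suc k)) n
  regroup : ∀ S B → 1ℚ + (S - B + 0ℚ) ≡ 1ℚ + S - B
  regroup = solve-∀ ℚ-ring

weightedDiagonal-suc-suc : ∀ p n →
  weightedDiagonal p (suc (suc n)) ≡ weightedDiagonal p (suc n) - p ^ suc n * diagonal p n
weightedDiagonal-suc-suc p n = begin
  1ℚ + diagonalSum (λ m k → p ^ suc k * W m (suc k)) (suc n)
    ≡⟨ cong (1ℚ +_) (diagonalSum-suc (λ m k → p ^ suc k * W m (suc k)) n) ⟩
  1ℚ + (diagonalSum (λ m k → p ^ suc k * (W m (suc k) - p ^ m * W m k)) n + last)
    ≡⟨ cong (λ s → 1ℚ + (s + last)) (diagonalSum-cong (λ m k → distribute p (p ^ k) (p ^ m) (W m (suc k)) (W m k)) n) ⟩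
  1ℚ + (diagonalSum (λ m k → p ^ suc k * W m (suc k) - p ^ m * p ^ k * (p * W m k)) n + last)
    ≡⟨ cong (λ s → 1ℚ + (s + last)) (diagonalSum-- (λ m k → p ^ suc k * W m (suc k)) (λ m k → p ^ m * p ^ k * (p * W m k)) n) ⟩
  1ℚ + (S - diagonalSum (λ m k → p ^ m * p ^ k * (p * W m k)) n + last)
    ≡⟨ cong (λ s → 1ℚ + (S - s + last)) (diagonalSum-homogeneous p (λ m k → p * W m k) n) ⟩
  1ℚ + (S - p ^ n * diagonalSum (λ m k → p * W m k) n + last)
    ≡⟨ cong (λ s → 1ℚ + (S - p ^ n * s + last)) (diagonalSum-*ˡ p W n) ⟩
  1ℚ + (S - p ^ n * (p * diagonal p n) + last)
    ≡⟨ regroup p (p ^ n) S (diagonal p n) (p ^ suc (suc n)) ⟩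
  1ℚ + S - p * p ^ n * diagonal p n
    ∎
  where
  W = signedGaussian p
  S = diagonalSum (λ m k → p ^ suc k * W m (suc k)) n
  last = p ^ suc (suc n) * 0ℚ
  distribute : ∀ p K M W₁ W₀ → p * K * (W₁ - M * W₀) ≡ p * K * W₁ - M * K * (p * W₀)
  distribute = solve-∀ ℚ-ring
  regroup : ∀ p N S A Z → 1ℚ + (S - N * (p * A) + Z * 0ℚ) ≡ 1ℚ + S - p * N * A
  regroup = solve-∀ ℚ-ring

diagonal-+3 : ∀ p n → diagonal p (3 ℕ.+ n) ≡ - p ^ suc n * diagonal p n
diagonal-+3 p n = begin
  diagonal p (3 ℕ.+ n)                                                ≡⟨ diagonal-suc-suc p (suc n) ⟩
  weightedDiagonal p (2 ℕ.+ n) - weightedDiagonal p (suc n)          ≡⟨ cong (_- weightedDiagonal p (suc n)) (weightedDiagonal-suc-suc p n) ⟩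
  weightedDiagonal p (suc n) - p ^ suc n * diagonal p n - weightedDiagonal p (suc n)
                                                                     ≡⟨ cancel (weightedDiagonal p (suc n)) (p ^ suc n) (diagonal p n) ⟩
  - p ^ suc n * diagonal p n                                         ∎
  where
  cancel : ∀ B P A → B - P * A - B ≡ - P * A
  cancel = solve-∀ ℚ-ring

unlessTwo : ℕ → ℚ
unlessTwo 2 = 0ℚ
unlessTwo _ = 1ℚ

signedPower : ℚ → ℕ → ℚ
signedPower q n = (- 1ℚ) ^ (n / 3) * q ^- (n ℕ.* (n ∸ 1) / 6)

rhs≡unlessTwo*signedPower : ∀ q n → rhs q n ≡ unlessTwo (n % 3) * signedPower q n
rhs≡unlessTwo*signedPower q n with n % 3
... | 0                 = sym (*-identityˡ (signedPower q n))
... | 1                 = sym (*-identityˡ (signedPower q n))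
... | 2                 = sym (*-zeroˡ (signedPower q n))
... | suc (suc (suc _)) = sym (*-identityˡ (signedPower q n))

[3+n]/3≡1+n/3 : ∀ n → (3 ℕ.+ n) / 3 ≡ suc (n / 3)
[3+n]/3≡1+n/3 n = m/n≡1+[m∸n]/n {3 ℕ.+ n} {3} (s≤s (s≤s (s≤s z≤n)))

triangular-+3 : ∀ n → (3 ℕ.+ n) ℕ.* (2 ℕ.+ n) / 6 ≡ n ℕ.* (n ∸ 1) / 6 ℕ.+ suc n
triangular-+3 n = begin
  (3 ℕ.+ n) ℕ.* (2 ℕ.+ n) / 6             ≡⟨ /-congˡ (product n) ⟩
  (n ℕ.* (n ∸ 1) ℕ.+ suc n ℕ.* 6) / 6     ≡⟨ +-distrib-/-∣ʳ (n ℕ.* (n ∸ 1)) (divides (suc n) refl) ⟩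
  n ℕ.* (n ∸ 1) / 6 ℕ.+ suc n ℕ.* 6 / 6   ≡⟨ cong (n ℕ.* (n ∸ 1) / 6 ℕ.+_) (m*n/n≡m (suc n) 6) ⟩
  n ℕ.* (n ∸ 1) / 6 ℕ.+ suc n             ∎
  where
  product : ∀ n → (3 ℕ.+ n) ℕ.* (2 ℕ.+ n) ≡ n ℕ.* (n ∸ 1) ℕ.+ suc n ℕ.* 6
  product zero    = refl
  product (suc n) = expand n
    where
    expand : ∀ m → (4 ℕ.+ m) ℕ.* (3 ℕ.+ m) ≡ suc m ℕ.* m ℕ.+ (2 ℕ.+ m) ℕ.* 6
    expand = ℕ-Solver.solve-∀

signedPower-+3 : ∀ q n → signedPower q (3 ℕ.+ n) ≡ - inv q ^ suc n * signedPower q n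
signedPower-+3 q n = begin
  (- 1ℚ) ^ ((3 ℕ.+ n) / 3) * q⁻¹ ^ ((3 ℕ.+ n) ℕ.* (2 ℕ.+ n) / 6)
    ≡⟨ cong₂ (λ s e → (- 1ℚ) ^ s * q⁻¹ ^ e) ([3+n]/3≡1+n/3 n) (triangular-+3 n) ⟩
  (- 1ℚ) ^ suc (n / 3) * q⁻¹ ^ (n ℕ.* (n ∸ 1) / 6 ℕ.+ suc n)
    ≡⟨ cong ((- 1ℚ) ^ suc (n / 3) *_) (^-+ q⁻¹ (n ℕ.* (n ∸ 1) / 6) (suc n)) ⟩
  - 1ℚ * (- 1ℚ) ^ (n / 3) * (q⁻¹ ^ (n ℕ.* (n ∸ 1) / 6) * q⁻¹ ^ suc n)
    ≡⟨ regroup ((- 1ℚ) ^ (n / 3)) (q⁻¹ ^ (n ℕ.* (n ∸ 1) / 6)) (q⁻¹ ^ suc n) ⟩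
  - q⁻¹ ^ suc n * signedPower q n
    ∎
  where
  q⁻¹ = inv q
  regroup : ∀ S E P → - 1ℚ * S * (E * P) ≡ - P * (S * E)
  regroup = solve-∀ ℚ-ring

rhs-+3 : ∀ q n → rhs q (3 ℕ.+ n) ≡ - inv q ^ suc n * rhs q n
rhs-+3 q n = begin
  -- (3 + n) % 3 reduces to n % 3 by evaluation.
  rhs q (3 ℕ.+ n)                                          ≡⟨ rhs≡unlessTwo*signedPower q (3 ℕ.+ n) ⟩
  unlessTwo (n % 3) * signedPower q (3 ℕ.+ n)              ≡⟨ cong (unlessTwo (n % 3) *_) (signedPower-+3 q n) ⟩
  unlessTwo (n % 3) * (- inv q ^ suc n * signedPower q n)  ≡⟨ x∙yz≈y∙xz (unlessTwo (n % 3)) (- inv q ^ suc n) (signedPower q n) ⟩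
  - inv q ^ suc n * (unlessTwo (n % 3) * signedPower q n)  ≡⟨ cong (- inv q ^ suc n *_) (rhs≡unlessTwo*signedPower q n) ⟨
  - inv q ^ suc n * rhs q n                                ∎

diagonal≡rhs : ∀ q n → diagonal (inv q) n ≡ rhs q n
diagonal≡rhs q 0 = refl
diagonal≡rhs q 1 = refl
diagonal≡rhs q 2 = refl
diagonal≡rhs q (suc (suc (suc n))) = begin
  diagonal (inv q) (3 ℕ.+ n)                   ≡⟨ diagonal-+3 (inv q) n ⟩
  - inv q ^ suc n * diagonal (inv q) n         ≡⟨ cong (- inv q ^ suc n *_) (diagonal≡rhs q n) ⟩
  - inv q ^ suc n * rhs q n                    ≡⟨ rhs-+3 q n ⟨
  rhs q (3 ℕ.+ n)                              ∎

term≡signedGaussian : q ≢ 0ℚ → (∀ j → q ^ suc j ≢ 1ℚ) → k ≤ n → term q n k ≡ signedGaussian (inv q) (n ∸ k) k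
term≡signedGaussian {q} {k} {n} q≢0 qʲ⁺¹≢1 k≤n = begin
  qPoch (q⁻¹ ^ n) q (2 ℕ.* k) * inv (Q * N) * q ^ k    ≡⟨ cong (λ P → P * inv (Q * N) * q ^ k) split ⟩
  N * R * inv (Q * N) * q ^ k                          ≡⟨ regroup N R (inv (Q * N)) (q ^ k) ⟩
  N * (R * q ^ k) * inv (Q * N)                        ≡⟨ cong (λ P → N * P * inv (Q * N)) (signedGaussian-qPoch q⁻¹q≡1 (n ∸ k) k) ⟩
  N * (W * Q) * inv (Q * N)                            ≡⟨ regroup′ N W Q (inv (Q * N)) ⟩
  W * (Q * N * inv (Q * N))                            ≡⟨ cong (W *_) (*-inv (x*y≢0 Q≢0 N≢0)) ⟩
  W * 1ℚ                                               ≡⟨ *-identityʳ W ⟩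
  W                                                    ∎
  where
  q⁻¹ = inv q
  W = signedGaussian q⁻¹ (n ∸ k) k
  Q = qPoch q q k
  N = qPoch (q⁻¹ ^ n) q k
  R = qPoch (q⁻¹ ^ (n ∸ k)) q k

  q⁻¹q≡1 : q⁻¹ * q ≡ 1ℚ
  q⁻¹q≡1 = trans (*-comm q⁻¹ q) (*-inv q≢0)

  split : qPoch (q⁻¹ ^ n) q (2 ℕ.* k) ≡ N * R
  split = begin
    qPoch (q⁻¹ ^ n) q (k ℕ.+ (k ℕ.+ 0))     ≡⟨ cong (λ j → qPoch (q⁻¹ ^ n) q (k ℕ.+ j)) (ℕₚ.+-identityʳ k) ⟩
    qPoch (q⁻¹ ^ n) q (k ℕ.+ k)             ≡⟨ qPoch-+ (q⁻¹ ^ n) q k k ⟩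
    N * qPoch (q⁻¹ ^ n * q ^ k) q k         ≡⟨ cong (λ b → N * qPoch b q k) (^-cancel {q⁻¹} {q} q⁻¹q≡1 k (n ∸ k) (ℕₚ.m+[n∸m]≡n k≤n)) ⟩
    N * R                                   ∎

  Q≢0 : Q ≢ 0ℚ
  Q≢0 = qPoch-≢0 k (λ i _ → qʲ⁺¹≢1 i)

  q⁻¹ʲ⁺¹≢1 : ∀ j → q⁻¹ ^ suc j ≢ 1ℚ
  q⁻¹ʲ⁺¹≢1 j = ^-≢1-inverse {q⁻¹} {q} q⁻¹q≡1 (suc j) (qʲ⁺¹≢1 j)

  N≢0 : N ≢ 0ℚ
  N≢0 = qPoch-≢0 k factor≢1
    where
    factor≢1 : ∀ i → i < k → q⁻¹ ^ n * q ^ i ≢ 1ℚ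
    factor≢1 i i<k = subst (_≢ 1ℚ) (sym (^-cancel {q⁻¹} {q} q⁻¹q≡1 i (suc (n ∸ suc i)) i+[1+n∸[1+i]]≡n))
                                    (q⁻¹ʲ⁺¹≢1 (n ∸ suc i))
      where
      i+[1+n∸[1+i]]≡n : i ℕ.+ suc (n ∸ suc i) ≡ n
      i+[1+n∸[1+i]]≡n = trans (ℕₚ.+-suc i (n ∸ suc i)) (ℕₚ.m+[n∸m]≡n (ℕₚ.≤-trans i<k k≤n))

  regroup : ∀ N R I x → N * R * I * x ≡ N * (R * x) * I
  regroup = solve-∀ ℚ-ring
  regroup′ : ∀ N W Q I → N * (W * Q) * I ≡ W * (Q * N * I)
  regroup′ = solve-∀ ℚ-ring

sumTo-cong : ∀ N {f g} → (∀ k → k ≤ N → f k ≡ g k) → sumTo N f ≡ sumTo N g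
sumTo-cong zero    f≗g = f≗g 0 z≤n
sumTo-cong (suc N) f≗g = cong₂ _+_ (sumTo-cong N (λ k k≤N → f≗g k (ℕₚ.m≤n⇒m≤1+n k≤N))) (f≗g (suc N) ℕₚ.≤-refl)

sumTo-suc : ∀ N f → sumTo (suc N) f ≡ f 0 + sumTo N (f ∘ suc)
sumTo-suc zero    f = refl
sumTo-suc (suc N) f = trans (cong (_+ f (2 ℕ.+ N)) (sumTo-suc N f)) (+-assoc (f 0) (sumTo N (f ∘ suc)) (f (2 ℕ.+ N)))

sumTo-zeroTail : ∀ {N M f} → N ≤ M → (∀ k → N < k → f k ≡ 0ℚ) → sumTo M f ≡ sumTo N f
sumTo-zeroTail {N} {M} {f} N≤M tail≡0 = go (ℕₚ.≤⇒≤′ N≤M)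
  where
  go : ∀ {M} → N ℕ.≤′ M → sumTo M f ≡ sumTo N f
  go ℕ.≤′-refl        = refl
  go (ℕ.≤′-step N≤′M) = trans (cong₂ _+_ (go N≤′M) (tail≡0 _ (s≤s (ℕₚ.≤′⇒≤ N≤′M)))) (+-identityʳ _)

diagonalSum≡sumTo : ∀ f n → diagonalSum f n ≡ sumTo n (λ k → f (n ∸ k) k)
diagonalSum≡sumTo f zero    = refl
diagonalSum≡sumTo f (suc n) = trans (cong (f (suc n) 0 +_) (diagonalSum≡sumTo (λ m k → f m (suc k)) n))
                                    (sym (sumTo-suc n (λ k → f (suc n ∸ k) k)))

n/2<k⇒n∸k<k : ∀ {n k} → n / 2 < k → n ∸ k < k
n/2<k⇒n∸k<k {n} {k@(suc _)} n/2<k = ℕₚ.m<n+o⇒m∸n<o n k (subst (n <_) (double k) (ℕₚ.≰⇒> 2k≰n))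
  where
  double : ∀ k → k ℕ.* 2 ≡ k ℕ.+ k
  double = ℕ-Solver.solve-∀
  2k≰n : ¬ (k ℕ.* 2 ≤ n)
  2k≰n 2k≤n = ℕₚ.<⇒≱ n/2<k (subst (_≤ n / 2) (m*n/n≡m k 2) (/-monoˡ-≤ 2 2k≤n))

mainTheorem7 : (n : ℕ) (q : ℚ) → q ≢ 0ℚ → q ≢ 1ℚ → q ≢ - 1ℚ →
    lhs q n ≡ rhs q n
mainTheorem7 n q q≢0 q≢1 q≢-1 = begin
  sumTo (n / 2) (term q n)              ≡⟨ sumTo-cong (n / 2) summand≡signedGaussian ⟩
  sumTo (n / 2) (λ k → W (n ∸ k) k)     ≡⟨ sumTo-zeroTail n/2≤n tail-vanishes ⟨
  sumTo n (λ k → W (n ∸ k) k)           ≡⟨ diagonalSum≡sumTo W n ⟨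
  diagonal (inv q) n                    ≡⟨ diagonal≡rhs q n ⟩
  rhs q n                               ∎
  where
  W = signedGaussian (inv q)
  n/2≤n = m/n≤m n 2

  summand≡signedGaussian : ∀ k → k ≤ n / 2 → term q n k ≡ W (n ∸ k) k
  summand≡signedGaussian k k≤n/2 = term≡signedGaussian q≢0 (^-suc-≢1 q≢0 q≢1 q≢-1) (ℕₚ.≤-trans k≤n/2 n/2≤n)

  tail-vanishes : ∀ k → n / 2 < k → W (n ∸ k) k ≡ 0ℚ
  tail-vanishes k n/2<k = signedGaussian-vanishes (inv q) (n/2<k⇒n∸k<k n/2<k)
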